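{- For $n\ge0$ let $P_n$ be the number of Motzkin prefixes of length $n$. Then $$P_n\equiv\begin{cases}1\pmod 3&\text{if } n\in 3T(01),\\ -1\pmod 3&\text{if } n\in 3T(01)+1 \text{ or } n\in 3T(01)-1,\\ 0\pmod 3&\text{otherwise.}\end{cases}$$
   Context: A Motzkin prefix of length $n$ is a lattice path in $\mathbb{N}\times\mathbb{N}$ (never going below the $x$-axis) consisting of $n$ steps from $\{(1,1),(1,-1),(1,0)\}$, starting at $(0,0)$, with arbitrary endpoint. $T(01)$ denotes the set of $m\in\mathbb{N}$ whose base-$3$ expansion contains only the digits $0$ and $1$. For a set $X$ of integers and integers $k,l$, $kX+l=\{kx+l : x\in X\}$. -}

module Defs where

open import Data.Nat using (ℕ; zero; suc; _+_; _*_; _%_)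
open import Data.List using (List; []; _∷_; length; filter; concatMap; map)
open import Data.Maybe using (Maybe; just; nothing; is-just)
open import Data.Bool using (Bool; true; false; T)
open import Data.Unit using (⊤)
open import Data.Empty using (⊥)
open import Data.Product using (∃; _×_)
open import Relation.Binary.PropositionalEquality using (_≡_)
open import Relation.Nullary.Decidable using (Dec; yes; no)

data Step : Set where
  U D H : Step

walk : ℕ → List Step → Maybe ℕ
walk h [] = just h
walk h (U ∷ s) = walk (suc h) s
walk zero (D ∷ s) = nothing
walk (suc h) (D ∷ s) = walk h s
walk h (H ∷ s) = walk h s

isMotzkinPrefix : List Step → Bool
isMotzkinPrefix s = is-just (walk 0 s)

allSeqs : ℕ → List (List Step)
allSeqs zero = [] ∷ []
allSeqs (suc n) = concatMap (λ s → (U ∷ s) ∷ (D ∷ s) ∷ (H ∷ s) ∷ []) (allSeqs n)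

P : ℕ → ℕ
P n = length (filter (λ s → T? (isMotzkinPrefix s)) (allSeqs n))
  where
  T? : (b : Bool) → Dec (T b)
  T? true = yes _
  T? false = no (λ ())

-- Base-3 representation with digits 0 and 1 only:  m ∈ T(01).
data T01 : ℕ → Set where
  t0   : T01 0
  dig0 : ∀ {m} → T01 m → T01 (3 * m)
  dig1 : ∀ {m} → T01 m → T01 (3 * m + 1)

In3T01 : ℕ → Set
In3T01 n = ∃ λ m → T01 m × n ≡ 3 * m

In3T01+1 : ℕ → Set
In3T01+1 n = ∃ λ m → T01 m × n ≡ 3 * m + 1

In3T01-1 : ℕ → Set
In3T01-1 n = ∃ λ m → T01 m × n + 1 ≡ 3 * m

module Submission where

open import Defs
open import Data.Nat using (ℕ; _%_)
open import Data.Sum using (_⊎_)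
open import Data.Product using (_×_)
open import Relation.Nullary using (¬_)
open import Relation.Binary.PropositionalEquality using (_≡_)

open import Data.Bool using (Bool; true; false; T)
open import Data.Fin using (Fin; toℕ)
open import Data.Fin.Patterns using (0F; 1F; 2F; 3F)
open import Data.Fin.Properties using (_≟_; all?; toℕ-fromℕ<; toℕ-injective)
open import Data.List using (List; []; _∷_; length; filter; concatMap)
open import Data.Maybe using (is-just)
open import Data.Nat using (zero; suc; _+_; _*_; _≤_; _<_; z≤n; s≤s; ∣_-_∣)
open import Data.Nat.Divisibility using (m∣m*n; n∣m⇒m%n≡0)
open import Data.Nat.DivMod using (_mod_; %-distribˡ-+; %-remove-+ˡ)
open import Data.Nat.Induction using (<-rec)
open import Data.Nat.Properties
  using (+-comm; +-suc; *-suc; +-identityʳ; +-cancelʳ-≡; suc-injective; m≤m+n; m<m+n)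
open import Data.Nat.Tactic.RingSolver using (solve-∀)
open import Data.Product using (_,_)
open import Data.Sum using (inj₁; inj₂; [_,_]′)
open import Data.Unit using (tt)
open import Function using (_∘_)
open import Relation.Nullary using (Dec; yes; no; contradiction)
open import Relation.Nullary.Decidable using (from-yes)
open import Relation.Binary.PropositionalEquality
  using (refl; sym; trans; cong; cong₂; subst; _≗_; module ≡-Reasoning)

-- Let T(n, j) be the coefficient of x^j in (x⁻¹ + 1 + x)ⁿ.  Counting Motzkin
-- prefixes by their first step gives the same recursion in n as the one
-- satisfied by the window sums T(n, −h) + ⋯ + T(n, h + 1) (reflection
-- principle), so P n = T(n, 0) + T(n, 1); as T(n + 1, 0) = T(n, 0) + 2 T(n, 1),
-- this says 2 P n = T(n, 0) + T(n + 1, 0).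
-- Modulo 3, (x⁻¹ + 1 + x)³ ≡ x⁻³ + 1 + x³, so T(3m, ·) is T(m, ·) spread out
-- by a factor 3.  Hence T(3m, 0) ≡ T(3m + 1, 0) ≡ T(m, 0) and T(3m + 2, 0) ≡ 0,
-- that is T(n, 0) ≡ [n ∈ T(01)], and P n ≡ 2 ([n ∈ T(01)] + [n + 1 ∈ T(01)]).
-- The three cases of the theorem are the possible memberships of n and n + 1.

⟦_⟧ : Bool → ℕ
⟦ true ⟧ = 1
⟦ false ⟧ = 0

count : {A : Set} → (A → Bool) → List A → ℕ
count p [] = 0
count p (x ∷ xs) = ⟦ p x ⟧ + count p xs

length-filter≡count : {A : Set} (p : A → Bool) (p? : ∀ x → Dec (T (p x))) (xs : List A) →
                      length (filter p? xs) ≡ count p xs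
length-filter≡count p p? [] = refl
length-filter≡count p p? (x ∷ xs) with p x | p? x
... | true  | yes _ = cong suc (length-filter≡count p p? xs)
... | true  | no ¬t = contradiction tt ¬t
... | false | no  _ = length-filter≡count p p? xs

count-false : {A : Set} (xs : List A) → count (λ _ → false) xs ≡ 0
count-false [] = refl
count-false (x ∷ xs) = count-false xs

extend : List Step → List (List Step)
extend s = (U ∷ s) ∷ (D ∷ s) ∷ (H ∷ s) ∷ []

count-concatMap-extend : (p : List Step → Bool) (ss : List (List Step)) →
  count p (concatMap extend ss) ≡ count (p ∘ (U ∷_)) ss + count (p ∘ (D ∷_)) ss + count (p ∘ (H ∷_)) ss
count-concatMap-extend p [] = refl
count-concatMap-extend p (s ∷ ss) =
  trans (cong (λ t → ⟦ p (U ∷ s) ⟧ + (⟦ p (D ∷ s) ⟧ + (⟦ p (H ∷ s) ⟧ + t))) (count-concatMap-extend p ss))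
        (interchange ⟦ p (U ∷ s) ⟧ ⟦ p (D ∷ s) ⟧ ⟦ p (H ∷ s) ⟧ _ _ _)
  where
  interchange : ∀ a b c x y z → a + (b + (c + (x + y + z))) ≡ (a + x) + (b + y) + (c + z)
  interchange = solve-∀

prefixes : ℕ → ℕ → ℕ
prefixes h n = count (is-just ∘ walk h) (allSeqs n)

P≡prefixes : ∀ n → P n ≡ prefixes 0 n
P≡prefixes n = length-filter≡count isMotzkinPrefix _ (allSeqs n)

prefixes-suc-zero : ∀ n → prefixes 0 (suc n) ≡ prefixes 1 n + prefixes 0 n
prefixes-suc-zero n =
  trans (count-concatMap-extend (is-just ∘ walk 0) (allSeqs n))
        (trans (cong (λ t → prefixes 1 n + t + prefixes 0 n) (count-false (allSeqs n)))
               (cong (_+ prefixes 0 n) (+-identityʳ (prefixes 1 n))))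

prefixes-suc-suc : ∀ h n →
  prefixes (suc h) (suc n) ≡ prefixes (2 + h) n + prefixes h n + prefixes (suc h) n
prefixes-suc-suc h n = count-concatMap-extend (is-just ∘ walk (suc h)) (allSeqs n)

-- A sequence c : ℕ → A stands for the symmetric Laurent polynomial with
-- coefficient c j at both x^j and x^(−j); mulTrinomial d multiplies it by
-- x^(−d) + 1 + x^d, the coefficient at x^(j − d) being read at ∣ d - j ∣.
module Trinomial {A : Set} (0# 1# : A) (_⊕_ : A → A → A) where

  mulTrinomial : ℕ → (ℕ → A) → ℕ → A
  mulTrinomial d c j = (c ∣ d - j ∣ ⊕ c j) ⊕ c (d + j)

  mulTrinomial-cong : ∀ d {c c′ : ℕ → A} → c ≗ c′ → mulTrinomial d c ≗ mulTrinomial d c′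
  mulTrinomial-cong d c≗c′ j = cong₂ _⊕_ (cong₂ _⊕_ (c≗c′ ∣ d - j ∣) (c≗c′ j)) (c≗c′ (d + j))

  δ : ℕ → A
  δ zero = 1#
  δ (suc _) = 0#

  trinomial : ℕ → ℕ → A
  trinomial zero = δ
  trinomial (suc n) = mulTrinomial 1 (trinomial n)

  spread : (ℕ → A) → ℕ → A
  spread c zero = c 0
  spread c (suc zero) = 0#
  spread c (suc (suc zero)) = 0#
  spread c (suc (suc (suc k))) = spread (c ∘ suc) k

open Trinomial 0 1 _+_ using (mulTrinomial; δ; trinomial)

-- The sum of the coefficients at x^(−h), …, x^(h + 1).
windowSum : ℕ → (ℕ → ℕ) → ℕ
windowSum zero c = c 0 + c 1
windowSum (suc h) c = windowSum h c + c (suc h) + c (2 + h)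

windowSum-δ : ∀ h → windowSum h δ ≡ 1
windowSum-δ zero = refl
windowSum-δ (suc h) = trans (+-identityʳ _) (trans (+-identityʳ _) (windowSum-δ h))

windowSum-mul-zero : ∀ c → windowSum 0 (mulTrinomial 1 c) ≡ windowSum 1 c + windowSum 0 c
windowSum-mul-zero c = shuffle (c 0) (c 1) (c 2)
  where
  shuffle : ∀ a b c → (b + a + b) + (a + b + c) ≡ (a + b + b + c) + (a + b)
  shuffle = solve-∀

windowSum-mul-suc : ∀ c h → windowSum (suc h) (mulTrinomial 1 c) ≡
                    windowSum (2 + h) c + windowSum h c + windowSum (suc h) c
windowSum-mul-suc c zero = shuffle (c 0) (c 1) (c 2) (c 3)
  where
  shuffle : ∀ a b c d → (b + a + b) + (a + b + c) + (a + b + c) + (b + c + d) ≡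
                        (a + b + b + c + c + d) + (a + b) + (a + b + b + c)
  shuffle = solve-∀
windowSum-mul-suc c (suc h) =
  trans (cong (λ t → t + mulTrinomial 1 c (2 + h) + mulTrinomial 1 c (3 + h)) (windowSum-mul-suc c h))
        (shuffle (windowSum (2 + h) c) (windowSum h c) (windowSum (1 + h) c)
                 (c (1 + h)) (c (2 + h)) (c (3 + h)) (c (4 + h)))
  where
  shuffle : ∀ X Y Z a b c d → X + Y + Z + (a + b + c) + (b + c + d) ≡ (X + c + d) + (Y + a + b) + (Z + b + c)
  shuffle = solve-∀

prefixes≡windowSum : ∀ n h → prefixes h n ≡ windowSum h (trinomial n)
prefixes≡windowSum zero h = sym (windowSum-δ h)
prefixes≡windowSum (suc n) zero =
  trans (prefixes-suc-zero n)
        (trans (cong₂ _+_ (prefixes≡windowSum n 1) (prefixes≡windowSum n 0))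
               (sym (windowSum-mul-zero (trinomial n))))
prefixes≡windowSum (suc n) (suc h) =
  trans (prefixes-suc-suc h n)
        (trans (cong₂ _+_ (cong₂ _+_ (prefixes≡windowSum n (2 + h)) (prefixes≡windowSum n h))
                          (prefixes≡windowSum n (suc h)))
               (sym (windowSum-mul-suc (trinomial n) h)))

P+P≡central+central : ∀ n → P n + P n ≡ trinomial n 0 + trinomial (suc n) 0
P+P≡central+central n = begin
  P n + P n                            ≡⟨ cong (λ p → p + p) (trans (P≡prefixes n) (prefixes≡windowSum n 0)) ⟩
  (a + b) + (a + b)                    ≡⟨ shuffle a b ⟩
  a + ((b + a) + b)                    ∎
  where
  open ≡-Reasoning
  a b : ℕ
  a = trinomial n 0
  b = trinomial n 1
  shuffle : ∀ a b → (a + b) + (a + b) ≡ a + ((b + a) + b)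
  shuffle = solve-∀

𝔽₃ : Set
𝔽₃ = Fin 3

infixl 6 _⊕_
_⊕_ : 𝔽₃ → 𝔽₃ → 𝔽₃
a ⊕ b = (toℕ a + toℕ b) mod 3

toℕ-mod3 : ∀ n → toℕ (n mod 3) ≡ n % 3
toℕ-mod3 n = toℕ-fromℕ< _

mod3-distrib-+ : ∀ m n → (m + n) mod 3 ≡ m mod 3 ⊕ n mod 3
mod3-distrib-+ m n = toℕ-injective (begin
  toℕ ((m + n) mod 3)                     ≡⟨ toℕ-mod3 (m + n) ⟩
  (m + n) % 3                             ≡⟨ %-distribˡ-+ m n 3 ⟩
  (m % 3 + n % 3) % 3                     ≡⟨ cong₂ (λ x y → (x + y) % 3) (toℕ-mod3 m) (toℕ-mod3 n) ⟨
  (toℕ (m mod 3) + toℕ (n mod 3)) % 3     ≡⟨ toℕ-mod3 (toℕ (m mod 3) + toℕ (n mod 3)) ⟨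
  toℕ (m mod 3 ⊕ n mod 3)                 ∎)
  where open ≡-Reasoning

double : 𝔽₃ → 𝔽₃
double x = x ⊕ x

double-involutive : ∀ x → double (double x) ≡ x
double-involutive = from-yes (all? λ x → double (double x) ≟ x)

module Mod3 = Trinomial 0F 1F _⊕_
open Mod3 using (spread)
  renaming (mulTrinomial to mulTrinomial₃; mulTrinomial-cong to mulTrinomial₃-cong; trinomial to trinomial₃; δ to δ₃)

mod3-mulTrinomial : ∀ d c → (_mod 3) ∘ mulTrinomial d c ≗ mulTrinomial₃ d ((_mod 3) ∘ c)
mod3-mulTrinomial d c j =
  trans (mod3-distrib-+ (c ∣ d - j ∣ + c j) (c (d + j)))
        (cong (_⊕ c (d + j) mod 3) (mod3-distrib-+ (c ∣ d - j ∣) (c j)))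

mod3-trinomial : ∀ n → (_mod 3) ∘ trinomial n ≗ trinomial₃ n
mod3-trinomial zero zero = refl
mod3-trinomial zero (suc j) = refl
mod3-trinomial (suc n) j =
  trans (mod3-mulTrinomial 1 (trinomial n) j) (mulTrinomial₃-cong 1 (mod3-trinomial n) j)

double-P≡central⊕central : ∀ n → double (P n mod 3) ≡ trinomial₃ n 0 ⊕ trinomial₃ (suc n) 0
double-P≡central⊕central n = begin
  P n mod 3 ⊕ P n mod 3                                 ≡⟨ mod3-distrib-+ (P n) (P n) ⟨
  (P n + P n) mod 3                                     ≡⟨ cong (_mod 3) (P+P≡central+central n) ⟩
  (trinomial n 0 + trinomial (suc n) 0) mod 3           ≡⟨ mod3-distrib-+ (trinomial n 0) (trinomial (suc n) 0) ⟩
  trinomial n 0 mod 3 ⊕ trinomial (suc n) 0 mod 3       ≡⟨ cong₂ _⊕_ (mod3-trinomial n 0) (mod3-trinomial (suc n) 0) ⟩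
  trinomial₃ n 0 ⊕ trinomial₃ (suc n) 0                 ∎
  where open ≡-Reasoning

P%3≡double : ∀ n {a b} → trinomial₃ n 0 ≡ a → trinomial₃ (suc n) 0 ≡ b → P n % 3 ≡ toℕ (double (a ⊕ b))
P%3≡double n refl refl = begin
  P n % 3                             ≡⟨ toℕ-mod3 (P n) ⟨
  toℕ (P n mod 3)                     ≡⟨ cong toℕ (double-involutive (P n mod 3)) ⟨
  toℕ (double (double (P n mod 3)))   ≡⟨ cong (toℕ ∘ double) (double-P≡central⊕central n) ⟩
  toℕ (double (trinomial₃ n 0 ⊕ trinomial₃ (suc n) 0)) ∎
  where open ≡-Reasoning

finite : List 𝔽₃ → ℕ → 𝔽₃
finite [] _ = 0F
finite (a ∷ as) zero = a
finite (a ∷ as) (suc i) = finite as i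

cube-finite : ∀ (j : Fin 4) a b c d e f g → let s = finite (a ∷ b ∷ c ∷ d ∷ e ∷ f ∷ g ∷ []) in
  mulTrinomial₃ 1 (mulTrinomial₃ 1 (mulTrinomial₃ 1 s)) (toℕ j) ≡ mulTrinomial₃ 3 s (toℕ j)
cube-finite = from-yes (all? λ (j : Fin 4) → all? λ a → all? λ b → all? λ c → all? λ d →
  all? λ e → all? λ f → all? λ g → let s = finite (a ∷ b ∷ c ∷ d ∷ e ∷ f ∷ g ∷ []) in
  mulTrinomial₃ 1 (mulTrinomial₃ 1 (mulTrinomial₃ 1 s)) (toℕ j) ≟ mulTrinomial₃ 3 s (toℕ j))

-- Frobenius: (x⁻¹ + 1 + x)³ ≡ x⁻³ + 1 + x³ modulo 3.  At j = 3 + k both sides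
-- read c at k, …, k + 6 exactly as they read a finite sequence at 0, …, 6, and
-- at j < 3 they read c below 7, so cube-finite covers every index.
cube : ∀ c → mulTrinomial₃ 1 (mulTrinomial₃ 1 (mulTrinomial₃ 1 c)) ≗ mulTrinomial₃ 3 c
cube c 0 = cube-finite 0F (c 0) (c 1) (c 2) (c 3) (c 4) (c 5) (c 6)
cube c 1 = cube-finite 1F (c 0) (c 1) (c 2) (c 3) (c 4) (c 5) (c 6)
cube c 2 = cube-finite 2F (c 0) (c 1) (c 2) (c 3) (c 4) (c 5) (c 6)
cube c (suc (suc (suc k))) =
  cube-finite 3F (c k) (c (1 + k)) (c (2 + k)) (c (3 + k)) (c (4 + k)) (c (5 + k)) (c (6 + k))

spread-⊕ : ∀ p q k → spread p k ⊕ spread q k ≡ spread (λ i → p i ⊕ q i) k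
spread-⊕ p q 0 = refl
spread-⊕ p q 1 = refl
spread-⊕ p q 2 = refl
spread-⊕ p q (suc (suc (suc k))) = spread-⊕ (p ∘ suc) (q ∘ suc) k

mulTrinomial-spread : ∀ c → mulTrinomial₃ 3 (spread c) ≗ spread (mulTrinomial₃ 1 c)
mulTrinomial-spread c 0 = refl
mulTrinomial-spread c 1 = refl
mulTrinomial-spread c 2 = refl
mulTrinomial-spread c (suc (suc (suc k))) =
  trans (cong (_⊕ spread (c ∘ suc ∘ suc) k) (spread-⊕ c (c ∘ suc) k))
        (spread-⊕ (λ i → c i ⊕ c (suc i)) (c ∘ suc ∘ suc) k)

spread-zero : ∀ k → spread (λ _ → 0F) k ≡ 0F
spread-zero 0 = refl
spread-zero 1 = refl
spread-zero 2 = refl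
spread-zero (suc (suc (suc k))) = spread-zero k

spread-δ : spread δ₃ ≗ δ₃
spread-δ 0 = refl
spread-δ 1 = refl
spread-δ 2 = refl
spread-δ (suc (suc (suc k))) = spread-zero k

frobenius : ∀ m → trinomial₃ (3 * m) ≗ spread (trinomial₃ m)
frobenius zero j = sym (spread-δ j)
frobenius (suc m) j = begin
  trinomial₃ (3 * suc m) j
    ≡⟨ cong (λ n → trinomial₃ n j) (*-suc 3 m) ⟩
  mulTrinomial₃ 1 (mulTrinomial₃ 1 (mulTrinomial₃ 1 (trinomial₃ (3 * m)))) j
    ≡⟨ mulTrinomial₃-cong 1 (mulTrinomial₃-cong 1 (mulTrinomial₃-cong 1 (frobenius m))) j ⟩
  mulTrinomial₃ 1 (mulTrinomial₃ 1 (mulTrinomial₃ 1 (spread (trinomial₃ m)))) j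
    ≡⟨ cube (spread (trinomial₃ m)) j ⟩
  mulTrinomial₃ 3 (spread (trinomial₃ m)) j
    ≡⟨ mulTrinomial-spread (trinomial₃ m) j ⟩
  spread (trinomial₃ (suc m)) j
    ∎
  where open ≡-Reasoning

central-3* : ∀ m → trinomial₃ (3 * m) 0 ≡ trinomial₃ m 0
central-3* m = frobenius m 0

-- Near 0, spread c is read only at its value c 0, so the last steps below are
-- identities in one variable of 𝔽₃, decided by evaluation.
central-3*+1 : ∀ m → trinomial₃ (3 * m + 1) 0 ≡ trinomial₃ m 0
central-3*+1 m = begin
  trinomial₃ (3 * m + 1) 0                    ≡⟨ cong (λ n → trinomial₃ n 0) (+-comm (3 * m) 1) ⟩
  mulTrinomial₃ 1 (trinomial₃ (3 * m)) 0      ≡⟨ mulTrinomial₃-cong 1 (frobenius m) 0 ⟩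
  mulTrinomial₃ 1 (spread (trinomial₃ m)) 0   ≡⟨ from-yes (all? λ x → mulTrinomial₃ 1 (spread (λ _ → x)) 0 ≟ x)
                                                            (trinomial₃ m 0) ⟩
  trinomial₃ m 0                              ∎
  where open ≡-Reasoning

central-3*+2 : ∀ m → trinomial₃ (3 * m + 2) 0 ≡ 0F
central-3*+2 m = begin
  trinomial₃ (3 * m + 2) 0
    ≡⟨ cong (λ n → trinomial₃ n 0) (trans (+-suc (3 * m) 1) (cong suc (+-comm (3 * m) 1))) ⟩
  mulTrinomial₃ 1 (mulTrinomial₃ 1 (trinomial₃ (3 * m))) 0
    ≡⟨ mulTrinomial₃-cong 1 (mulTrinomial₃-cong 1 (frobenius m)) 0 ⟩
  mulTrinomial₃ 1 (mulTrinomial₃ 1 (spread (trinomial₃ m))) 0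
    ≡⟨ from-yes (all? λ x → mulTrinomial₃ 1 (mulTrinomial₃ 1 (spread (λ _ → x))) 0 ≟ 0F) (trinomial₃ m 0) ⟩
  0F
    ∎
  where open ≡-Reasoning

data Residue3 : ℕ → Set where
  3*_   : ∀ k → Residue3 (3 * k)
  3*_+1 : ∀ k → Residue3 (3 * k + 1)
  3*_+2 : ∀ k → Residue3 (3 * k + 2)

residue3 : ∀ n → Residue3 n
residue3 zero = 3* 0
residue3 (suc n) with residue3 n
... | 3* k   = subst Residue3 (+-comm (3 * k) 1) (3* k +1)
... | 3* k +1 = subst Residue3 (+-suc (3 * k) 1) (3* k +2)
... | 3* k +2 = subst Residue3 (3[1+k]≡1+[3k+2] k) (3* suc k)
  where
  3[1+k]≡1+[3k+2] : ∀ k → 3 * (1 + k) ≡ 1 + (3 * k + 2)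
  3[1+k]≡1+[3k+2] = solve-∀

T01⇒central≡1 : ∀ {m} → T01 m → trinomial₃ m 0 ≡ 1F
T01⇒central≡1 t0 = refl
T01⇒central≡1 (dig0 {m} t) = trans (central-3* m) (T01⇒central≡1 t)
T01⇒central≡1 (dig1 {m} t) = trans (central-3*+1 m) (T01⇒central≡1 t)

¬T01⇒central≡0 : ∀ m → ¬ T01 m → trinomial₃ m 0 ≡ 0F
¬T01⇒central≡0 = <-rec _ step
  where
  step : ∀ m → (∀ {k} → k < m → ¬ T01 k → trinomial₃ k 0 ≡ 0F) → ¬ T01 m → trinomial₃ m 0 ≡ 0F
  step m rec ¬t with residue3 m
  ... | 3* zero  = contradiction t0 ¬t
  ... | 3* suc k = trans (central-3* (suc k)) (rec (m<m+n (suc k) (s≤s z≤n)) (¬t ∘ dig0))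
  ... | 3* k +1  = trans (central-3*+1 k) (rec (subst (k <_) (+-comm 1 (3 * k)) (s≤s (m≤m+n k (2 * k)))) (¬t ∘ dig1))
  ... | 3* k +2  = central-3*+2 k

T01⇒%3≤1 : ∀ {n} → T01 n → n % 3 ≤ 1
T01⇒%3≤1 t0 = z≤n
T01⇒%3≤1 (dig0 {m} _) rewrite n∣m⇒m%n≡0 (3 * m) 3 (m∣m*n m) = z≤n
T01⇒%3≤1 (dig1 {m} _) rewrite %-remove-+ˡ 1 (m∣m*n {3} m) = s≤s z≤n

¬T01-3*+2 : ∀ {k} → ¬ T01 (3 * k + 2)
¬T01-3*+2 {k} t with subst (_≤ 1) (%-remove-+ˡ 2 (m∣m*n {3} k)) (T01⇒%3≤1 t)
... | s≤s ()

T01⇒In3T01⊎In3T01+1 : ∀ {n} → T01 n → In3T01 n ⊎ In3T01+1 n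
T01⇒In3T01⊎In3T01+1 t0 = inj₁ (0 , t0 , refl)
T01⇒In3T01⊎In3T01+1 (dig0 t) = inj₁ (_ , t , refl)
T01⇒In3T01⊎In3T01+1 (dig1 t) = inj₂ (_ , t , refl)

T01-suc⇒In3T01⊎In3T01-1 : ∀ {n} → T01 (suc n) → In3T01 n ⊎ In3T01-1 n
T01-suc⇒In3T01⊎In3T01-1 = go refl
  where
  go : ∀ {n x} → x ≡ suc n → T01 x → In3T01 n ⊎ In3T01-1 n
  go {n} e (dig0 {m} t) = inj₂ (m , t , trans (+-comm n 1) (sym e))
  go {n} e (dig1 {m} t) = inj₁ (m , t , suc-injective (trans (sym e) (+-comm (3 * m) 1)))

In3T01⇒T01∧T01-suc : ∀ {n} → In3T01 n → T01 n × T01 (suc n)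
In3T01⇒T01∧T01-suc (m , t , refl) = dig0 t , subst T01 (+-comm (3 * m) 1) (dig1 {m} t)

In3T01+1⇒T01∧¬T01-suc : ∀ {n} → In3T01+1 n → T01 n × ¬ T01 (suc n)
In3T01+1⇒T01∧¬T01-suc (m , t , refl) = dig1 t , ¬T01-3*+2 {m} ∘ subst T01 (sym (+-suc (3 * m) 1))

¬T01-pred-3* : ∀ {n m} → n + 1 ≡ 3 * m → ¬ T01 n
¬T01-pred-3* {n} {zero} e = contradiction (trans (+-comm 1 n) e) λ ()
¬T01-pred-3* {n} {suc k} e = ¬T01-3*+2 {k} ∘ subst T01 (+-cancelʳ-≡ 1 n (3 * k + 2) (trans e (3[1+k]≡3k+2+1 k)))
  where
  3[1+k]≡3k+2+1 : ∀ k → 3 * (1 + k) ≡ 3 * k + 2 + 1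
  3[1+k]≡3k+2+1 = solve-∀

In3T01-1⇒¬T01∧T01-suc : ∀ {n} → In3T01-1 n → ¬ T01 n × T01 (suc n)
In3T01-1⇒¬T01∧T01-suc {n} (m , t , e) = ¬T01-pred-3* {n} {m} e , subst T01 (sym (trans (+-comm 1 n) e)) (dig0 {m} t)

corollary4p9 : (n : ℕ) →
    (In3T01 n → P n % 3 ≡ 1) ×
    ((In3T01+1 n ⊎ In3T01-1 n) → P n % 3 ≡ 2) ×
    ((¬ In3T01 n × ¬ In3T01+1 n × ¬ In3T01-1 n) → P n % 3 ≡ 0)
corollary4p9 n =
    (λ i → let t , t′ = In3T01⇒T01∧T01-suc i in P%3≡double n (T01⇒central≡1 t) (T01⇒central≡1 t′))
  , [ (λ i → let t , ¬t′ = In3T01+1⇒T01∧¬T01-suc i in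
             P%3≡double n (T01⇒central≡1 t) (¬T01⇒central≡0 (suc n) ¬t′))
    , (λ i → let ¬t , t′ = In3T01-1⇒¬T01∧T01-suc i in
             P%3≡double n (¬T01⇒central≡0 n ¬t) (T01⇒central≡1 t′)) ]′
  , λ (¬i , ¬i+1 , ¬i-1) →
      P%3≡double n (¬T01⇒central≡0 n (λ t → [ ¬i , ¬i+1 ]′ (T01⇒In3T01⊎In3T01+1 t)))
          (¬T01⇒central≡0 (suc n) (λ t → [ ¬i , ¬i-1 ]′ (T01-suc⇒In3T01⊎In3T01-1 t)))
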